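{- Let $G$ be the sibling tree $ST_3$. Then $\gamma^{L}(G)=6$.
   Context: The sibling tree $ST_n$ has vertex set $\{1,\dots,2^{n+1}-1\}$; its edges are the complete binary tree edges $\{x,2x\},\{x,2x+1\}$ for $1\le x\le 2^n-1$ together with the sibling edges $\{2x,2x+1\}$ for $1\le x\le 2^n-1$. A locating-dominating set is a set $S$ such that every vertex outside $S$ has a neighbor in $S$ and distinct $u,v\notin S$ satisfy $N(u)\cap S\ne N(v)\cap S$ (open neighborhoods); $\gamma^{L}(G)$ is its minimum cardinality. -}

module Defs where

open import Data.Nat using (ℕ; suc; _+_; _*_; _∸_; _^_; _≤_)
open import Data.Fin using (Fin; toℕ)
open import Data.Fin.Subset using (Subset; _∈_; _∉_; ∣_∣)
open import Data.Product using (Σ; ∃; _×_; _,_)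
open import Data.Sum using (_⊎_)
open import Relation.Nullary using (¬_)
open import Relation.Binary.PropositionalEquality using (_≡_; _≢_)
open import Function.Bundles using (_⇔_)

-- Vertices of ST_n: Fin (2^(n+1) - 1); vertex i has label (toℕ i + 1) ∈ {1,…,2^(n+1)-1}.
order : ℕ → ℕ
order n = 2 ^ suc n ∸ 1

Vertex : ℕ → Set
Vertex n = Fin (order n)

label : (n : ℕ) → Vertex n → ℕ
label n v = suc (toℕ v)

-- Directed description of the edges of ST_n on labels:
-- {z,2z}, {z,2z+1} (tree edges) and {2z,2z+1} (sibling edges), for 1 ≤ z ≤ 2^n - 1.
STEdge : ℕ → ℕ → ℕ → Set
STEdge n x y = ∃ λ z → (1 ≤ z) × (z ≤ 2 ^ n ∸ 1) ×
  ((x ≡ z × y ≡ 2 * z) ⊎ (x ≡ z × y ≡ 2 * z + 1) ⊎ (x ≡ 2 * z × y ≡ 2 * z + 1))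

Adj : (n : ℕ) → Vertex n → Vertex n → Set
Adj n u v = STEdge n (label n u) (label n v) ⊎ STEdge n (label n v) (label n u)

IsLocDom : (n : ℕ) → Subset (order n) → Set
IsLocDom n S =
  (∀ u → u ∉ S → ∃ λ v → v ∈ S × Adj n u v) ×
  (∀ u w → u ∉ S → w ∉ S → u ≢ w →
     ¬ (∀ x → x ∈ S → (Adj n u x ⇔ Adj n w x)))

LocDomNumber : ℕ → ℕ → Set
LocDomNumber n k =
  (∃ λ S → IsLocDom n S × ∣ S ∣ ≡ k) × (∀ S → IsLocDom n S → k ≤ ∣ S ∣)

module Submission where

-- Then {2,3,8,10,12,14} is locating-dominating, and the
-- search over the 4944 subsets of at most 5 vertices finds no
-- locating-dominating set, which is the lower bound.

open import Defs
open import Data.Bool using (Bool; true; false; T; not; _∧_; _∨_)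
open import Data.Bool.Properties using (T-≡)
open import Data.Nat using (ℕ; zero; suc; _+_; _*_; _∸_; _^_; _%_; _≤_; z≤n; s≤s; s≤s⁻¹; _≟_; _≤?_; _≡ᵇ_; anyUpTo?)
open import Data.Nat.Properties using (≰⇒>; ≡ᵇ⇒≡; ≡⇒≡ᵇ)
open import Data.Fin using (Fin; toℕ)
open import Data.Fin.Properties using (all?; toℕ-injective)
open import Data.Fin.Subset using (Subset; inside; outside; _∈_; _∉_; ∣_∣)
open import Data.Vec using ([]; _∷_; lookup)
open import Data.Vec.Properties using ([]=⇒lookup; lookup⇒[]=)
open import Data.Product using (∃; _×_; _,_; uncurry)
open import Data.Sum using (_⊎_; inj₁; inj₂)
open import Function using (_∘_)
open import Function.Bundles using (_⇔_; mk⇔; Equivalence)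
open import Relation.Nullary using (Dec; _because_; proof; ¬_; ¬?)
open import Relation.Nullary.Decidable using (map′; T?; _×-dec_; _⊎-dec_; from-yes)
open import Relation.Nullary.Reflects using (Reflects; ofʸ; ofⁿ; fromEquivalence; ¬-reflects; _×-reflects_; _⊎-reflects_; _→-reflects_)
open import Relation.Binary.PropositionalEquality using (_≡_; _≢_; refl; cong)

map-reflects : ∀ {a b} {A : Set a} {B : Set b} {x : Bool} → (A → B) → (B → A) → Reflects A x → Reflects B x
map-reflects f g (ofʸ a) = ofʸ (f a)
map-reflects f g (ofⁿ ¬a) = ofⁿ (¬a ∘ g)

_⇔ᵇ_ : Bool → Bool → Bool
x ⇔ᵇ y = (not x ∨ y) ∧ (not y ∨ x)

⇔-reflects : ∀ {a b} {A : Set a} {B : Set b} {x y : Bool} → Reflects A x → Reflects B y → Reflects (A ⇔ B) (x ⇔ᵇ y)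
⇔-reflects rA rB =
  map-reflects (uncurry mk⇔) (λ e → Equivalence.to e , Equivalence.from e)
               ((rA →-reflects rB) ×-reflects (rB →-reflects rA))

_⇔-dec_ : ∀ {a b} {A : Set a} {B : Set b} → Dec A → Dec B → Dec (A ⇔ B)
a? ⇔-dec b? = _ because ⇔-reflects (proof a?) (proof b?)

allᵇ : ∀ {n} → (Fin n → Bool) → Bool
allᵇ {zero} p = true
allᵇ {suc n} p = p Fin.zero ∧ allᵇ (p ∘ Fin.suc)

anyᵇ : ∀ {n} → (Fin n → Bool) → Bool
anyᵇ {zero} p = false
anyᵇ {suc n} p = p Fin.zero ∨ anyᵇ (p ∘ Fin.suc)

∀-reflects : ∀ {n ℓ} {P : Fin n → Set ℓ} {p : Fin n → Bool} →
             (∀ i → Reflects (P i) (p i)) → Reflects (∀ i → P i) (allᵇ p)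
∀-reflects {zero} r = ofʸ λ ()
∀-reflects {suc n} r =
  map-reflects (λ { (p₀ , ps) Fin.zero → p₀ ; (p₀ , ps) (Fin.suc i) → ps i })
               (λ f → f Fin.zero , f ∘ Fin.suc)
               (r Fin.zero ×-reflects ∀-reflects (r ∘ Fin.suc))

∃-reflects : ∀ {n ℓ} {P : Fin n → Set ℓ} {p : Fin n → Bool} →
             (∀ i → Reflects (P i) (p i)) → Reflects (∃ P) (anyᵇ p)
∃-reflects {zero} r = ofⁿ λ ()
∃-reflects {suc n} r =
  map-reflects (λ { (inj₁ p₀) → Fin.zero , p₀ ; (inj₂ (i , pᵢ)) → Fin.suc i , pᵢ })
               (λ { (Fin.zero , p₀) → inj₁ p₀ ; (Fin.suc i , pᵢ) → inj₂ (i , pᵢ) })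
               (r Fin.zero ⊎-reflects ∃-reflects (r ∘ Fin.suc))

∈-reflects : ∀ {n} (i : Fin n) (S : Subset n) → Reflects (i ∈ S) (lookup S i)
∈-reflects i S = fromEquivalence (lookup⇒[]= i S ∘ Equivalence.to T-≡) (Equivalence.from T-≡ ∘ []=⇒lookup)

≡-reflects : ∀ {n} (u w : Fin n) → Reflects (u ≡ w) (toℕ u ≡ᵇ toℕ w)
≡-reflects u w = fromEquivalence (toℕ-injective ∘ ≡ᵇ⇒≡ (toℕ u) (toℕ w)) (≡⇒≡ᵇ (toℕ u) (toℕ w) ∘ cong toℕ)

stEdge? : ∀ n x y → Dec (STEdge n x y)
stEdge? n x y =
  map′ (λ { (z , z<m , 1≤z , c) → z , 1≤z , s≤s⁻¹ z<m , c })
       (λ { (z , 1≤z , z≤m , c) → z , s≤s z≤m , 1≤z , c })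
       (anyUpTo? (λ z → (1 ≤? z) ×-dec edgeShape? z) (suc (2 ^ n ∸ 1)))
  where
  edgeShape? : ∀ z → Dec ((x ≡ z × y ≡ 2 * z) ⊎ (x ≡ z × y ≡ 2 * z + 1) ⊎ (x ≡ 2 * z × y ≡ 2 * z + 1))
  edgeShape? z =
    ((x ≟ z) ×-dec (y ≟ 2 * z)) ⊎-dec ((x ≟ z) ×-dec (y ≟ 2 * z + 1))
      ⊎-dec ((x ≟ 2 * z) ×-dec (y ≟ 2 * z + 1))

adj? : ∀ n (u v : Vertex n) → Dec (Adj n u v)
adj? n u v = stEdge? n (label n u) (label n v) ⊎-dec stEdge? n (label n v) (label n u)

module LocatingDomination (n : ℕ) (adjᵇ : Vertex n → Vertex n → Bool)
                          (adj-reflects : ∀ u v → Reflects (Adj n u v) (adjᵇ u v)) where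

  dominatingᵇ : Subset (order n) → Bool
  dominatingᵇ S = allᵇ λ u → not (not (lookup S u)) ∨ anyᵇ λ v → lookup S v ∧ adjᵇ u v

  sameTraceᵇ : Subset (order n) → Vertex n → Vertex n → Bool
  sameTraceᵇ S u w = allᵇ λ x → not (lookup S x) ∨ (adjᵇ u x ⇔ᵇ adjᵇ w x)

  locatingᵇ : Subset (order n) → Bool
  locatingᵇ S = allᵇ λ u → allᵇ λ w →
    not (not (lookup S u)) ∨ (not (not (lookup S w)) ∨ (not (not (toℕ u ≡ᵇ toℕ w)) ∨ not (sameTraceᵇ S u w)))

  -- The test decides IsLocDom n S; the proof of correctness is never run
  -- during the search, only the boolean.
  isLocDom? : ∀ S → Dec (IsLocDom n S)
  isLocDom? S = dominatingᵇ S ∧ locatingᵇ S because (dominating-reflects ×-reflects locating-reflects)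
    where
    ∉-reflects : ∀ u → Reflects (u ∉ S) (not (lookup S u))
    ∉-reflects u = ¬-reflects (∈-reflects u S)
    dominating-reflects : Reflects (∀ u → u ∉ S → ∃ λ v → v ∈ S × Adj n u v) (dominatingᵇ S)
    dominating-reflects = ∀-reflects λ u → ∉-reflects u →-reflects ∃-reflects λ v → ∈-reflects v S ×-reflects adj-reflects u v
    sameTrace-reflects : ∀ u w → Reflects (∀ x → x ∈ S → (Adj n u x ⇔ Adj n w x)) (sameTraceᵇ S u w)
    sameTrace-reflects u w = ∀-reflects λ x → ∈-reflects x S →-reflects ⇔-reflects (adj-reflects u x) (adj-reflects w x)
    locating-reflects : Reflects (∀ u w → u ∉ S → w ∉ S → u ≢ w → ¬ (∀ x → x ∈ S → (Adj n u x ⇔ Adj n w x))) (locatingᵇ S)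
    locating-reflects = ∀-reflects λ u → ∀-reflects λ w →
      ∉-reflects u →-reflects ∉-reflects w →-reflects ¬-reflects (≡-reflects u w) →-reflects ¬-reflects (sameTrace-reflects u w)

allSubsetsUpTo? : ∀ {n p} {P : Subset n → Set p} → (∀ S → Dec (P S)) →
                  ∀ k → Dec (∀ S → ∣ S ∣ ≤ k → P S)
allSubsetsUpTo? {zero} P? k = map′ (λ p → λ { [] _ → p }) (λ f → f [] z≤n) (P? [])
allSubsetsUpTo? {suc n} P? zero =
  map′ (λ f → λ { (outside ∷ S) → f S ; (inside ∷ S) () })
       (λ f S → f (outside ∷ S))
       (allSubsetsUpTo? (P? ∘ (outside ∷_)) zero)
allSubsetsUpTo? {suc n} P? (suc k) =
  map′ (λ { (f , g) → λ { (outside ∷ S) → f S ; (inside ∷ S) (s≤s c) → g S c } })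
       (λ f → (λ S → f (outside ∷ S)) , (λ S c → f (inside ∷ S) (s≤s c)))
       (allSubsetsUpTo? (P? ∘ (outside ∷_)) (suc k) ×-dec allSubsetsUpTo? (P? ∘ (inside ∷_)) k)

stEdgeᵇ : ℕ → ℕ → Bool
stEdgeᵇ x y = (y ≡ᵇ 2 * x) ∨ (y ≡ᵇ 2 * x + 1) ∨ ((x % 2 ≡ᵇ 0) ∧ (y ≡ᵇ x + 1))

adjST₃ᵇ : Vertex 3 → Vertex 3 → Bool
adjST₃ᵇ u v = stEdgeᵇ (label 3 u) (label 3 v) ∨ stEdgeᵇ (label 3 v) (label 3 u)

adjST₃-reflects : ∀ u v → Reflects (Adj 3 u v) (adjST₃ᵇ u v)
adjST₃-reflects u v = fromEquivalence (Equivalence.to (agree u v)) (Equivalence.from (agree u v))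
  where
  agree : ∀ u v → T (adjST₃ᵇ u v) ⇔ Adj 3 u v
  agree = from-yes (all? λ u → all? λ v → T? (adjST₃ᵇ u v) ⇔-dec adj? 3 u v)

open LocatingDomination 3 adjST₃ᵇ adjST₃-reflects using (isLocDom?)

-- The vertices {2,3,8,10,12,14} (indices are labels minus one).
optimalSet : Subset 15
optimalSet = outside ∷ inside ∷ inside ∷ outside ∷ outside ∷ outside ∷ outside ∷ inside
           ∷ outside ∷ inside ∷ outside ∷ inside ∷ outside ∷ inside ∷ outside ∷ []

optimalSet-locDom : IsLocDom 3 optimalSet
optimalSet-locDom = from-yes (isLocDom? optimalSet)

noSmallLocDom : ∀ S → ∣ S ∣ ≤ 5 → ¬ IsLocDom 3 S
noSmallLocDom = from-yes (allSubsetsUpTo? (¬? ∘ isLocDom?) 5)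

lemma10 : LocDomNumber 3 6
lemma10 = (optimalSet , optimalSet-locDom , refl) , atLeastSix
  where
  atLeastSix : ∀ S → IsLocDom 3 S → 6 ≤ ∣ S ∣
  atLeastSix S ld = ≰⇒> (λ small → noSmallLocDom S small ld)
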